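{- A signed complete bigraph is a chordal signed bigraph if and only if it does not contain any of the following five signed graphs as an induced subgraph: (M1) $K_{2,2}$ with all edges negative; (M2) $K_{2,3}$ with parts $\{a,b\}$, $\{p,q,r\}$, where $pa,aq,qb,br$ are negative and $bp,ar$ are positive; (M3) $K_{2,4}$ with parts $\{a,b\}$, $\{p,q,r,s\}$, where $ap,aq,br,bs$ are negative and $bp,bq,ar,as$ are positive; (M4) $K_{3,3}$ with parts $\{a,b,c\}$, $\{p,q,r\}$, where $ap,bq,cr$ are negative and the other six edges are positive; (M5) $K_{3,3}$ with parts $\{a,b,c\}$, $\{p,q,r\}$, where $ap,aq,bq,cr$ are negative and $ar,br,bp,cp,cq$ are positive.
   Context: A signed graph is a finite simple graph in which every edge is assigned a sign, positive or negative; induced subgraphs inherit signs, and containment as an induced subgraph is up to sign-preserving isomorphism. A signed bigraph has bipartite underlying graph with fixed bipartition $(X,Y)$; it is a signed complete bigraph if the underlying graph is complete bipartite. A subgraph $H$ is a biclique if every vertex of $V(H)\cap X$ is adjacent to every vertex of $V(H)\cap Y$; positive if all edges are positive. For an edge $uv$, $N(uv)=(N(u)\cup N(v))\setminus\{u,v\}$; $uv$ is signed simplicial if the subgraph induced by $N(uv)$ is a positive biclique. A signed bigraph is a chordal signed bigraph if its edges can be ordered $e_1,\dots,e_m$ so that each $e_i$ is signed simplicial in the signed bigraph obtained by deleting edges $e_1,\dots,e_{i-1}$ (keeping all vertices). -}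

module Defs where

open import Data.Nat using (ℕ; _+_)
open import Data.Fin using (Fin; zero; suc; splitAt; _≟_)
open import Data.Sum using (_⊎_; inj₁; inj₂)
open import Data.Maybe using (Maybe; just; nothing)
open import Data.Product using (Σ; _×_; _,_)
open import Relation.Binary.PropositionalEquality using (_≡_; _≢_; refl)
open import Relation.Nullary using (¬_; yes; no)
open import Function.Definitions using (Injective)

data Sign : Set where
  pos neg : Sign

-- General signed graphs (finite simple graphs with signed edges).
-- Vertices are Fin n; edge u v = nothing means "not adjacent",
-- edge u v = just s means "adjacent by an edge of sign s".

record SignedGraph : Set where
  field
    n      : ℕ
    edge   : Fin n → Fin n → Maybe Sign
    sym    : ∀ u v → edge u v ≡ edge v u
    irrefl : ∀ v → edge v v ≡ nothing
open SignedGraph public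

-- H is an induced subgraph of G up to sign-preserving isomorphism:
-- an injective vertex map preserving adjacency, non-adjacency and signs.
_⊑_ : SignedGraph → SignedGraph → Set
H ⊑ G = Σ (Fin (n H) → Fin (n G)) λ f →
          Injective _≡_ _≡_ f × (∀ i j → edge G (f i) (f j) ≡ edge H i j)

-- Signed bigraphs with fixed bipartition (X , Y) = (Fin m , Fin k).
-- E x y = nothing: x,y not adjacent; E x y = just s: edge xy of sign s.
-- (Every edge of a bigraph joins X to Y, so this is all the data.)

Bigraph : ℕ → ℕ → Set
Bigraph m k = Fin m → Fin k → Maybe Sign

Adj : ∀ {m k} → Bigraph m k → Fin m → Fin k → Set
Adj E x y = Σ Sign λ s → E x y ≡ just s

complete : ∀ {m k} → (Fin m → Fin k → Sign) → Bigraph m k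
complete S x y = just (S x y)

delete : ∀ {m k} → Bigraph m k → Fin m → Fin k → Bigraph m k
delete E x y x' y' with x ≟ x' | y ≟ y'
... | yes _ | yes _ = nothing
... | _     | _     = E x' y'

-- The edge xy is signed simplicial: the subgraph induced by
-- N(xy) = (N(x) ∪ N(y)) \ {x,y} is a positive biclique.
-- N(xy) ∩ X = N(y) \ {x},  N(xy) ∩ Y = N(x) \ {y}.
SignedSimplicial : ∀ {m k} → Bigraph m k → Fin m → Fin k → Set
SignedSimplicial E x y =
  (∀ x' y' → x' ≢ x → y' ≢ y → Adj E x' y → Adj E x y' → Adj E x' y')
  ×
  (∀ x' y' → x' ≢ x → y' ≢ y → Adj E x' y → Adj E x y' →
     ∀ s → E x' y' ≡ just s → s ≡ pos)

-- Chordal E: the edges of E can be listed e₁,…,e_m so that each eᵢ is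
-- signed simplicial after deleting e₁,…,e_{i-1}.
data Chordal {m k : ℕ} : Bigraph m k → Set where
  done : ∀ {E} → (∀ x y → E x y ≡ nothing) → Chordal E
  step : ∀ {E} x y → Adj E x y → SignedSimplicial E x y →
         Chordal (delete E x y) → Chordal E

-- Underlying signed graph of a bigraph, on vertex set Fin (m + k)
-- (first m vertices form X, the last k form Y).

adj' : ∀ {m k} → Bigraph m k → Fin m ⊎ Fin k → Fin m ⊎ Fin k → Maybe Sign
adj' E (inj₁ x) (inj₂ y) = E x y
adj' E (inj₂ y) (inj₁ x) = E x y
adj' E (inj₁ _) (inj₁ _) = nothing
adj' E (inj₂ _) (inj₂ _) = nothing

adj'-sym : ∀ {m k} (E : Bigraph m k) a b → adj' E a b ≡ adj' E b a
adj'-sym E (inj₁ x) (inj₁ y) = refl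
adj'-sym E (inj₁ x) (inj₂ y) = refl
adj'-sym E (inj₂ x) (inj₁ y) = refl
adj'-sym E (inj₂ x) (inj₂ y) = refl

adj'-irr : ∀ {m k} (E : Bigraph m k) a → adj' E a a ≡ nothing
adj'-irr E (inj₁ x) = refl
adj'-irr E (inj₂ y) = refl

toGraph : ∀ {m k} → Bigraph m k → SignedGraph
toGraph {m} {k} E = record
  { n      = m + k
  ; edge   = λ u v → adj' E (splitAt m u) (splitAt m v)
  ; sym    = λ u v → adj'-sym E (splitAt m u) (splitAt m v)
  ; irrefl = λ v → adj'-irr E (splitAt m v)
  }

K : ∀ a b → (Fin a → Fin b → Sign) → SignedGraph
K a b S = toGraph (complete S)

M1-signs : Fin 2 → Fin 2 → Sign
M1-signs _ _ = neg

M1 : SignedGraph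
M1 = K 2 2 M1-signs

M2-signs : Fin 2 → Fin 3 → Sign
M2-signs zero zero = neg
M2-signs zero (suc zero) = neg
M2-signs zero (suc (suc zero)) = pos
M2-signs (suc zero) zero = pos
M2-signs (suc zero) (suc zero) = neg
M2-signs (suc zero) (suc (suc zero)) = neg

M2 : SignedGraph
M2 = K 2 3 M2-signs

M3-signs : Fin 2 → Fin 4 → Sign
M3-signs zero zero = neg
M3-signs zero (suc zero) = neg
M3-signs zero (suc (suc zero)) = pos
M3-signs zero (suc (suc (suc zero))) = pos
M3-signs (suc zero) zero = pos
M3-signs (suc zero) (suc zero) = pos
M3-signs (suc zero) (suc (suc zero)) = neg
M3-signs (suc zero) (suc (suc (suc zero))) = neg

M3 : SignedGraph
M3 = K 2 4 M3-signs

M4-signs : Fin 3 → Fin 3 → Sign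
M4-signs zero zero = neg
M4-signs zero (suc zero) = pos
M4-signs zero (suc (suc zero)) = pos
M4-signs (suc zero) zero = pos
M4-signs (suc zero) (suc zero) = neg
M4-signs (suc zero) (suc (suc zero)) = pos
M4-signs (suc (suc zero)) zero = pos
M4-signs (suc (suc zero)) (suc zero) = pos
M4-signs (suc (suc zero)) (suc (suc zero)) = neg

M4 : SignedGraph
M4 = K 3 3 M4-signs

M5-signs : Fin 3 → Fin 3 → Sign
M5-signs zero zero = neg
M5-signs zero (suc zero) = neg
M5-signs zero (suc (suc zero)) = pos
M5-signs (suc zero) zero = pos
M5-signs (suc zero) (suc zero) = neg
M5-signs (suc zero) (suc (suc zero)) = pos
M5-signs (suc (suc zero)) zero = pos
M5-signs (suc (suc zero)) (suc zero) = pos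
M5-signs (suc (suc zero)) (suc (suc zero)) = neg

M5 : SignedGraph
M5 = K 3 3 M5-signs

-- An induced copy of any of M1–M5 survives every elimination step: each of its
-- edges xy faces a negative edge x′y′ of the copy with x′ ≠ x and y′ ≠ y, so it is
-- never signed simplicial. Conversely, the edges of an M-free signed complete
-- bigraph are eliminated row by row. If R is the set of rows still present, a row
-- x ∈ R whose removal leaves the negative edges of R − x in a single column (a
-- pivot) can be emptied first, starting with that column: each of its edges is
-- then signed simplicial. A pivot always exists: a row with two negative edges is
-- one (by M1–M5 and the transpose of M2), and if every row has at most one
-- negative edge, a set R without pivot contains M4 or the transpose of M3.

module Submission where

open import Defs hiding (sym)
open import Data.Nat using (ℕ; suc; _+_)
open import Data.Fin using (Fin; zero; suc; splitAt; join; _≟_)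
open import Data.Fin.Properties using (splitAt-join; join-splitAt; any?; all?)
open import Data.Fin.Subset using (Subset; _∈_; _∉_; _⊂_; _-_; ⊤; Nonempty; Empty)
open import Data.Fin.Subset.Properties
  using (_∈?_; nonempty?; ∈⊤; p─q⊆p; x∈p∧x≢y⇒x∈p-y; x∈p⇒p-x⊂p)
open import Data.Fin.Subset.Induction using (⊂-wellFounded)
open import Data.Sum using (_⊎_; inj₁; inj₂; swap; map)
open import Data.Sum.Properties using (inj₁-injective; inj₂-injective; swap-involutive)
open import Data.Maybe using (just; nothing)
open import Data.Maybe.Properties using (just-injective)
open import Data.Product using (∃; ∃₂; _×_; _,_; proj₁; proj₂)
open import Data.Empty using (⊥; ⊥-elim)
open import Data.Vec using ([]; _∷_; lookup; there)
open import Data.Vec.Relation.Unary.All using ([]; _∷_)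
open import Data.Vec.Relation.Unary.AllPairs using ([]; _∷_)
open import Data.Vec.Relation.Unary.Unique.Propositional using (Unique)
open import Data.Vec.Relation.Unary.Unique.Propositional.Properties using (lookup-injective)
open import Function using (_∘_; flip)
open import Function.Bundles using (_⇔_; mk⇔; Equivalence)
open import Function.Definitions using (Injective)
open import Induction.WellFounded using (Acc; acc)
open import Relation.Binary.PropositionalEquality
  using (_≡_; _≢_; refl; sym; trans; cong; cong₂; subst; module ≡-Reasoning)
open import Relation.Nullary using (¬_; Dec; yes; no)
open import Relation.Nullary.Decidable
  using (True; toWitness; from-yes; decidable-stable; _×-dec_; _⊎-dec_; _→-dec_; ¬?)

private
  variable
    a b m k : ℕ

_≟ˢ_ : (s t : Sign) → Dec (s ≡ t)
pos ≟ˢ pos = yes refl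
pos ≟ˢ neg = no λ ()
neg ≟ˢ pos = no λ ()
neg ≟ˢ neg = yes refl

≢neg⇒≡pos : ∀ {s} → s ≢ neg → s ≡ pos
≢neg⇒≡pos {pos} _    = refl
≢neg⇒≡pos {neg} s≢neg = ⊥-elim (s≢neg refl)

⇔-drop-¬ : {A B C : Set} → ¬ C → (A × ¬ C) ⇔ B → A ⇔ B
⇔-drop-¬ ¬c A∖C⇔B =
  mk⇔ (λ a → Equivalence.to A∖C⇔B (a , ¬c)) (proj₁ ∘ Equivalence.from A∖C⇔B)

x∉p-x : ∀ {n} (p : Subset n) x → x ∉ p - x
x∉p-x (_ ∷ p) zero    ()
x∉p-x (_ ∷ p) (suc x) (there x∈p-x) = x∉p-x p x x∈p-x

x∈p-y⇒x≢y : ∀ {n} {p : Subset n} {x y} → x ∈ p - y → x ≢ y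
x∈p-y⇒x≢y {p = p} {x} x∈p-x refl = x∉p-x p x x∈p-x

-- Induced copies of complete signed bigraphs

record _↪_ (F : Bigraph a b) (E : Bigraph m k) : Set where
  field
    vertex    : Fin a ⊎ Fin b → Fin m ⊎ Fin k
    injective : Injective _≡_ _≡_ vertex
    adjacency : ∀ p q → adj' E (vertex p) (vertex q) ≡ adj' F p q

toGraph-⊑⁺ : {F : Bigraph a b} {E : Bigraph m k} → F ↪ E → toGraph F ⊑ toGraph E
toGraph-⊑⁺ {a} {b} {m} {k} {F} {E} e = f , f-injective , f-adjacency
  where
  open _↪_ e
  open ≡-Reasoning
  f : Fin (a + b) → Fin (m + k)
  f = join m k ∘ vertex ∘ splitAt a

  f-injective : Injective _≡_ _≡_ f
  f-injective {u} {v} eq = begin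
    u                       ≡⟨ join-splitAt a b u ⟨
    join a b (splitAt a u)  ≡⟨ cong (join a b) (injective vertex-eq) ⟩
    join a b (splitAt a v)  ≡⟨ join-splitAt a b v ⟩
    v                       ∎
    where
    vertex-eq : vertex (splitAt a u) ≡ vertex (splitAt a v)
    vertex-eq = begin
      vertex (splitAt a u)  ≡⟨ splitAt-join m k _ ⟨
      splitAt m (f u)       ≡⟨ cong (splitAt m) eq ⟩
      splitAt m (f v)       ≡⟨ splitAt-join m k _ ⟩
      vertex (splitAt a v)  ∎

  f-adjacency : ∀ u v → adj' E (splitAt m (f u)) (splitAt m (f v)) ≡ adj' F (splitAt a u) (splitAt a v)
  f-adjacency u v =
    trans (cong₂ (adj' E) (splitAt-join m k (vertex (splitAt a u))) (splitAt-join m k (vertex (splitAt a v))))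
          (adjacency (splitAt a u) (splitAt a v))

toGraph-⊑⁻ : {F : Bigraph a b} {E : Bigraph m k} → toGraph F ⊑ toGraph E → F ↪ E
toGraph-⊑⁻ {a} {b} {m} {k} {F} {E} (f , f-injective , f-adjacency) = record
  { vertex    = vertex
  ; injective = vertex-injective
  ; adjacency = λ p q →
      trans (f-adjacency (join a b p) (join a b q)) (cong₂ (adj' F) (splitAt-join a b p) (splitAt-join a b q))
  }
  where
  open ≡-Reasoning
  vertex : Fin a ⊎ Fin b → Fin m ⊎ Fin k
  vertex = splitAt m ∘ f ∘ join a b

  vertex-injective : Injective _≡_ _≡_ vertex
  vertex-injective {p} {q} eq = begin
    p                       ≡⟨ splitAt-join a b p ⟨
    splitAt a (join a b p)  ≡⟨ cong (splitAt a) (f-injective f-eq) ⟩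
    splitAt a (join a b q)  ≡⟨ splitAt-join a b q ⟩
    q                       ∎
    where
    f-eq : f (join a b p) ≡ f (join a b q)
    f-eq = begin
      f (join a b p)             ≡⟨ join-splitAt m k _ ⟨
      join m k (vertex p)        ≡⟨ cong (join m k) eq ⟩
      join m k (vertex q)        ≡⟨ join-splitAt m k _ ⟩
      f (join a b q)             ∎

adj'-flip : (E : Bigraph m k) → ∀ p q → adj' (flip E) (swap p) (swap q) ≡ adj' E p q
adj'-flip E (inj₁ x) (inj₁ x′) = refl
adj'-flip E (inj₁ x) (inj₂ y)  = refl
adj'-flip E (inj₂ y) (inj₁ x)  = refl
adj'-flip E (inj₂ y) (inj₂ y′) = refl

↪-flip : {F : Bigraph a b} {E : Bigraph m k} → F ↪ flip E → F ↪ E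
↪-flip {E = E} e = record
  { vertex    = swap ∘ vertex
  ; injective = λ {p} {q} eq → injective (swap-injective eq)
  ; adjacency = λ p q → trans (adj'-flip (flip E) (vertex p) (vertex q)) (adjacency p q)
  }
  where
  open _↪_ e
  swap-injective : ∀ {A B : Set} {p q : A ⊎ B} → swap p ≡ swap q → p ≡ q
  swap-injective {p = p} {q} eq = trans (sym (swap-involutive p)) (trans (cong swap eq) (swap-involutive q))

record _≼_ (T : Fin a → Fin b → Sign) (E : Bigraph m k) : Set where
  constructor occurrence
  field
    row                : Fin a → Fin m
    column             : Fin b → Fin k
    row-injective      : Injective _≡_ _≡_ row
    column-injective   : Injective _≡_ _≡_ column
    entry              : ∀ i j → E (row i) (column j) ≡ just (T i j)

≼-flip : {T : Fin a → Fin b → Sign} {E : Bigraph m k} → T ≼ flip E → flip T ≼ E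
≼-flip (occurrence row column row-injective column-injective entry) =
  occurrence column row column-injective row-injective (flip entry)

≼⇒↪ : {T : Fin a → Fin b → Sign} {E : Bigraph m k} → T ≼ E → complete T ↪ E
≼⇒↪ {T = T} {E} (occurrence row column row-injective column-injective entry) = record
  { vertex    = map row column
  ; injective = vertex-injective
  ; adjacency = adjacency
  }
  where
  vertex-injective : Injective _≡_ _≡_ (map row column)
  vertex-injective {inj₁ i} {inj₁ i′} eq = cong inj₁ (row-injective (inj₁-injective eq))
  vertex-injective {inj₂ j} {inj₂ j′} eq = cong inj₂ (column-injective (inj₂-injective eq))

  adjacency : ∀ p q → adj' E (map row column p) (map row column q) ≡ adj' (complete T) p q
  adjacency (inj₁ i) (inj₁ i′) = refl
  adjacency (inj₁ i) (inj₂ j)  = entry i j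
  adjacency (inj₂ j) (inj₁ i)  = entry i j
  adjacency (inj₂ j) (inj₂ j′) = refl

flip≼⇒↪ : {T : Fin a → Fin b → Sign} {E : Bigraph m k} → flip T ≼ E → complete T ↪ E
flip≼⇒↪ = ↪-flip ∘ ≼⇒↪ ∘ ≼-flip

inj₁-if-adjacent-inj₂ : (E : Bigraph m k) → ∀ p y {s} →
  adj' E p (inj₂ y) ≡ just s → ∃ λ x → p ≡ inj₁ x
inj₁-if-adjacent-inj₂ E (inj₁ x) y _ = x , refl

inj₂-if-adjacent-inj₁ : (E : Bigraph m k) → ∀ x q {s} →
  adj' E (inj₁ x) q ≡ just s → ∃ λ y → q ≡ inj₂ y
inj₂-if-adjacent-inj₁ E x (inj₂ y) _ = y , refl

↪⇒≼-aligned : {T : Fin (suc a) → Fin (suc b) → Sign} {E : Bigraph m k} (e : complete T ↪ E) →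
  ∀ {x₀} → _↪_.vertex e (inj₁ zero) ≡ inj₁ x₀ → T ≼ E
↪⇒≼-aligned {T = T} {E} e {x₀} corner =
  occurrence (proj₁ ∘ row) (proj₁ ∘ column) row-injective column-injective entry
  where
  open _↪_ e
  column : ∀ j → ∃ λ y → vertex (inj₂ j) ≡ inj₂ y
  column j = inj₂-if-adjacent-inj₁ E x₀ (vertex (inj₂ j))
    (subst (λ v → adj' E v (vertex (inj₂ j)) ≡ just (T zero j)) corner (adjacency (inj₁ zero) (inj₂ j)))

  row : ∀ i → ∃ λ x → vertex (inj₁ i) ≡ inj₁ x
  row i = inj₁-if-adjacent-inj₂ E (vertex (inj₁ i)) (proj₁ (column zero))
    (subst (λ v → adj' E (vertex (inj₁ i)) v ≡ just (T i zero)) (proj₂ (column zero))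
      (adjacency (inj₁ i) (inj₂ zero)))

  row-injective : Injective _≡_ _≡_ (proj₁ ∘ row)
  row-injective {i} {i′} eq =
    inj₁-injective (injective (trans (proj₂ (row i)) (trans (cong inj₁ eq) (sym (proj₂ (row i′))))))

  column-injective : Injective _≡_ _≡_ (proj₁ ∘ column)
  column-injective {j} {j′} eq =
    inj₂-injective (injective (trans (proj₂ (column j)) (trans (cong inj₂ eq) (sym (proj₂ (column j′))))))

  entry : ∀ i j → E (proj₁ (row i)) (proj₁ (column j)) ≡ just (T i j)
  entry i j =
    trans (cong₂ (adj' E) (sym (proj₂ (row i))) (sym (proj₂ (column j)))) (adjacency (inj₁ i) (inj₂ j))

↪⇒≼ : {T : Fin (suc a) → Fin (suc b) → Sign} {E : Bigraph m k} →
  complete T ↪ E → T ≼ E ⊎ flip T ≼ E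
↪⇒≼ e with _↪_.vertex e (inj₁ zero) in corner
... | inj₁ x = inj₁ (↪⇒≼-aligned e corner)
... | inj₂ y = inj₂ (≼-flip (↪⇒≼-aligned (↪-flip e) (cong swap corner)))

-- The obstructions are not chordal

NoSimplicialEdge : (Fin a → Fin b → Sign) → Set
NoSimplicialEdge T = ∀ i j → ∃₂ λ i′ j′ → i′ ≢ i × j′ ≢ j × T i′ j′ ≡ neg

noSimplicialEdge? : (T : Fin a → Fin b → Sign) → Dec (NoSimplicialEdge T)
noSimplicialEdge? T = all? λ i → all? λ j → any? λ i′ → any? λ j′ →
  ¬? (i′ ≟ i) ×-dec ¬? (j′ ≟ j) ×-dec (T i′ j′ ≟ˢ neg)

NoSimplicialEdge-flip : {T : Fin a → Fin b → Sign} → NoSimplicialEdge T → NoSimplicialEdge (flip T)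
NoSimplicialEdge-flip noSimplicial j i =
  let i′ , j′ , i′≢i , j′≢j , negative = noSimplicial i j in j′ , i′ , j′≢j , i′≢i , negative

occurrence-not-simplicial : {T : Fin a → Fin b → Sign} {E : Bigraph m k} → NoSimplicialEdge T →
  (o : T ≼ E) → ∀ i j → ¬ SignedSimplicial E (_≼_.row o i) (_≼_.column o j)
occurrence-not-simplicial {T = T} noSimplicial (occurrence row column row-injective column-injective entry) i j
  (_ , positive) with noSimplicial i j
... | i′ , j′ , i′≢i , j′≢j , negative
  with trans (sym negative)
    (positive (row i′) (column j′) (i′≢i ∘ row-injective) (j′≢j ∘ column-injective)
              (T i′ j , entry i′ j) (T i j′ , entry i j′) (T i′ j′) (entry i′ j′))
... | ()

≼⇒¬Chordal : {T : Fin (suc a) → Fin (suc b) → Sign} {E : Bigraph m k} →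
  NoSimplicialEdge T → T ≼ E → ¬ Chordal E
≼⇒¬Chordal noSimplicial o (done empty) with trans (sym (_≼_.entry o zero zero)) (empty _ _)
... | ()
≼⇒¬Chordal {T = T} {E} noSimplicial o@(occurrence row column row-injective column-injective entry)
  (step x y _ simplicial rest) =
  ≼⇒¬Chordal noSimplicial (occurrence row column row-injective column-injective entry′) rest
  where
  entry′ : ∀ i j → delete E x y (row i) (column j) ≡ just (T i j)
  entry′ i j with x ≟ row i | y ≟ column j
  ... | yes refl | yes refl = ⊥-elim (occurrence-not-simplicial noSimplicial o i j simplicial)
  ... | yes _    | no _     = entry i j
  ... | no _     | _        = entry i j

⊑⇒¬Chordal : {T : Fin (suc a) → Fin (suc b) → Sign} {E : Bigraph m k} → NoSimplicialEdge T →
  toGraph (complete T) ⊑ toGraph E → ¬ Chordal E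
⊑⇒¬Chordal noSimplicial sub with ↪⇒≼ (toGraph-⊑⁻ sub)
... | inj₁ o = ≼⇒¬Chordal noSimplicial o
... | inj₂ o = ≼⇒¬Chordal (NoSimplicialEdge-flip noSimplicial) o

-- Elimination orderings

Adj-resp : {E E′ : Bigraph m k} → (∀ x y → E x y ≡ E′ x y) → ∀ {x y} → Adj E x y → Adj E′ x y
Adj-resp E≐E′ (s , e) = s , trans (sym (E≐E′ _ _)) e

SignedSimplicial-resp : {E E′ : Bigraph m k} → (∀ x y → E x y ≡ E′ x y) →
  ∀ {x y} → SignedSimplicial E x y → SignedSimplicial E′ x y
SignedSimplicial-resp E≐E′ (biclique , positive) =
  (λ x′ y′ x′≢x y′≢y x′y xy′ →
     Adj-resp E≐E′ (biclique x′ y′ x′≢x y′≢y (Adj-resp E′≐E x′y) (Adj-resp E′≐E xy′))) ,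
  (λ x′ y′ x′≢x y′≢y x′y xy′ s e →
     positive x′ y′ x′≢x y′≢y (Adj-resp E′≐E x′y) (Adj-resp E′≐E xy′) s (trans (E≐E′ x′ y′) e))
  where
  E′≐E : ∀ x y → _ ≡ _
  E′≐E x y = sym (E≐E′ x y)

delete-resp : {E E′ : Bigraph m k} → (∀ x y → E x y ≡ E′ x y) →
  ∀ x y x′ y′ → delete E x y x′ y′ ≡ delete E′ x y x′ y′
delete-resp E≐E′ x y x′ y′ with x ≟ x′ | y ≟ y′
... | yes _ | yes _ = refl
... | yes _ | no _  = E≐E′ x′ y′
... | no _  | _     = E≐E′ x′ y′

chordal-resp : {E E′ : Bigraph m k} → (∀ x y → E x y ≡ E′ x y) → Chordal E → Chordal E′
chordal-resp E≐E′ (done empty) = done λ x y → trans (sym (E≐E′ x y)) (empty x y)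
chordal-resp E≐E′ (step x y xy simplicial rest) =
  step x y (Adj-resp E≐E′ xy) (SignedSimplicial-resp E≐E′ simplicial)
    (chordal-resp (delete-resp E≐E′ x y) rest)

module _ (S : Fin m → Fin k → Sign) where

  spanning : {P : Fin m → Fin k → Set} → (∀ x y → Dec (P x y)) → Bigraph m k
  spanning P? x y with P? x y
  ... | yes _ = just (S x y)
  ... | no _  = nothing

  module _ {P : Fin m → Fin k → Set} (P? : ∀ x y → Dec (P x y)) {x : Fin m} {y : Fin k} where

    spanning-present : P x y → spanning P? x y ≡ just (S x y)
    spanning-present p with P? x y
    ... | yes _ = refl
    ... | no ¬p = ⊥-elim (¬p p)

    spanning-absent : ¬ P x y → spanning P? x y ≡ nothing
    spanning-absent ¬p with P? x y
    ... | yes p = ⊥-elim (¬p p)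
    ... | no _  = refl

    spanning-edge : ∀ {s} → spanning P? x y ≡ just s → P x y × S x y ≡ s
    spanning-edge e with P? x y
    ... | yes p = p , just-injective e

    spanning-cong : {Q : Fin m → Fin k → Set} (Q? : ∀ x y → Dec (Q x y)) →
      P x y ⇔ Q x y → spanning P? x y ≡ spanning Q? x y
    spanning-cong Q? P⇔Q with Q? x y
    ... | yes q = spanning-present (Equivalence.from P⇔Q q)
    ... | no ¬q = spanning-absent (¬q ∘ Equivalence.to P⇔Q)

  delete-spanning : {P Q : Fin m → Fin k → Set} (P? : ∀ x y → Dec (P x y)) (Q? : ∀ x y → Dec (Q x y)) →
    ∀ x y → (∀ x′ y′ → (P x′ y′ × ¬ (x ≡ x′ × y ≡ y′)) ⇔ Q x′ y′) →
    ∀ x′ y′ → delete (spanning P?) x y x′ y′ ≡ spanning Q? x′ y′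
  delete-spanning P? Q? x y P∖xy⇔Q x′ y′ with x ≟ x′ | y ≟ y′
  ... | yes x≡x′ | yes y≡y′ =
    sym (spanning-absent Q? λ q → proj₂ (Equivalence.from (P∖xy⇔Q x′ y′) q) (x≡x′ , y≡y′))
  ... | yes _    | no y≢y′  = spanning-cong P? Q? (⇔-drop-¬ (y≢y′ ∘ proj₂) (P∖xy⇔Q x′ y′))
  ... | no x≢x′  | _        = spanning-cong P? Q? (⇔-drop-¬ (x≢x′ ∘ proj₁) (P∖xy⇔Q x′ y′))

  TwoNegativeColumns : Subset m → Set
  TwoNegativeColumns R =
    ∃₂ λ x x′ → ∃₂ λ y y′ → x ∈ R × x′ ∈ R × y ≢ y′ × S x y ≡ neg × S x′ y′ ≡ neg

  twoNegativeColumns? : ∀ R → Dec (TwoNegativeColumns R)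
  twoNegativeColumns? R = any? λ x → any? λ x′ → any? λ y → any? λ y′ →
    x ∈? R ×-dec x′ ∈? R ×-dec ¬? (y ≟ y′) ×-dec S x y ≟ˢ neg ×-dec S x′ y′ ≟ˢ neg

  Pivot : Subset m → Fin m → Set
  Pivot R x = x ∈ R × ¬ TwoNegativeColumns (R - x)

  rows? : (R : Subset m) (x : Fin m) (y : Fin k) → Dec (x ∈ R)
  rows? R x _ = x ∈? R

  rows : Subset m → Bigraph m k
  rows R = spanning (rows? R)

  RowStage : Subset m → Fin m → Subset k → Fin m → Fin k → Set
  RowStage R x D x′ y′ = x′ ∈ R ⊎ (x′ ≡ x × y′ ∈ D)

  rowStage? : ∀ R x D x′ y′ → Dec (RowStage R x D x′ y′)
  rowStage? R x D x′ y′ = x′ ∈? R ⊎-dec (x′ ≟ x ×-dec y′ ∈? D)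

  rowStage : Subset m → Fin m → Subset k → Bigraph m k
  rowStage R x D = spanning (rowStage? R x D)

  rowStage-full : ∀ {R x} → x ∈ R → ∀ x′ y′ → RowStage (R - x) x ⊤ x′ y′ ⇔ x′ ∈ R
  rowStage-full {R} {x} x∈R x′ y′ = mk⇔ to from
    where
    to : RowStage (R - x) x ⊤ x′ y′ → x′ ∈ R
    to (inj₁ x′∈R-x)     = p─q⊆p R _ x′∈R-x
    to (inj₂ (refl , _)) = x∈R
    from : x′ ∈ R → RowStage (R - x) x ⊤ x′ y′
    from x′∈R with x′ ≟ x
    ... | yes x′≡x = inj₂ (x′≡x , ∈⊤)
    ... | no x′≢x  = inj₁ (x∈p∧x≢y⇒x∈p-y x′∈R x′≢x)

  rowStage-done : ∀ {R x D} → Empty D → ∀ x′ y′ → x′ ∈ R ⇔ RowStage R x D x′ y′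
  rowStage-done empty x′ y′ =
    mk⇔ inj₁ λ { (inj₁ x′∈R) → x′∈R ; (inj₂ (_ , y′∈D)) → ⊥-elim (empty (y′ , y′∈D)) }

  rowStage-delete : ∀ {R x D} → x ∉ R → ∀ y x′ y′ →
    (RowStage R x D x′ y′ × ¬ (x ≡ x′ × y ≡ y′)) ⇔ RowStage R x (D - y) x′ y′
  rowStage-delete {R} {x} {D} x∉R y x′ y′ = mk⇔ to from
    where
    to : RowStage R x D x′ y′ × ¬ (x ≡ x′ × y ≡ y′) → RowStage R x (D - y) x′ y′
    to (inj₁ x′∈R , _)            = inj₁ x′∈R
    to (inj₂ (refl , y′∈D) , ¬xy) = inj₂ (refl , x∈p∧x≢y⇒x∈p-y y′∈D λ y′≡y → ¬xy (refl , sym y′≡y))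
    from : RowStage R x (D - y) x′ y′ → RowStage R x D x′ y′ × ¬ (x ≡ x′ × y ≡ y′)
    from (inj₁ x′∈R) = inj₁ x′∈R , λ (x≡x′ , _) → x∉R (subst (_∈ R) (sym x≡x′) x′∈R)
    from (inj₂ (refl , y′∈D-y)) =
      inj₂ (refl , p─q⊆p D _ y′∈D-y) , λ (_ , y≡y′) → x∉p-x D y′ (subst (λ v → y′ ∈ D - v) y≡y′ y′∈D-y)

  rowStage-simplicial : ∀ {R x D y} → x ∉ R →
    (∀ x′ y′ → x′ ∈ R → y′ ∈ D → y′ ≢ y → S x′ y′ ≢ neg) → SignedSimplicial (rowStage R x D) x y
  rowStage-simplicial {R} {x} {D} {y} x∉R clear = biclique , positive
    where
    in-R : ∀ {x′} → x′ ≢ x → Adj (rowStage R x D) x′ y → x′ ∈ R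
    in-R x′≢x (_ , e) with proj₁ (spanning-edge (rowStage? R x D) e)
    ... | inj₁ x′∈R        = x′∈R
    ... | inj₂ (x′≡x , _) = ⊥-elim (x′≢x x′≡x)

    in-D : ∀ {y′} → Adj (rowStage R x D) x y′ → y′ ∈ D
    in-D (_ , e) with proj₁ (spanning-edge (rowStage? R x D) e)
    ... | inj₁ x∈R        = ⊥-elim (x∉R x∈R)
    ... | inj₂ (_ , y′∈D) = y′∈D

    biclique : ∀ x′ y′ → x′ ≢ x → y′ ≢ y → Adj (rowStage R x D) x′ y → Adj (rowStage R x D) x y′ →
      Adj (rowStage R x D) x′ y′
    biclique x′ y′ x′≢x _ x′y _ = S x′ y′ , spanning-present (rowStage? R x D) (inj₁ (in-R x′≢x x′y))

    positive : ∀ x′ y′ → x′ ≢ x → y′ ≢ y → Adj (rowStage R x D) x′ y → Adj (rowStage R x D) x y′ →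
      ∀ s → rowStage R x D x′ y′ ≡ just s → s ≡ pos
    positive x′ y′ x′≢x y′≢y x′y xy′ s e with spanning-edge (rowStage? R x D) e
    ... | _ , refl = ≢neg⇒≡pos (clear x′ y′ (in-R x′≢x x′y) (in-D xy′) y′≢y)

  -- A column carrying a negative edge of R has to be eliminated first.
  next-column : ∀ {R D} → ¬ TwoNegativeColumns R → Nonempty D →
    ∃ λ y → y ∈ D × (∀ x′ y′ → x′ ∈ R → y′ ∈ D → y′ ≢ y → S x′ y′ ≢ neg)
  next-column {R} {D} oneColumn (y₀ , y₀∈D)
    with any? (λ y → y ∈? D ×-dec any? λ x → x ∈? R ×-dec S x y ≟ˢ neg)
  ... | yes (y , y∈D , x , x∈R , xy) = y , y∈D , λ x′ y′ x′∈R _ y′≢y x′y′ →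
    oneColumn (x , x′ , y , y′ , x∈R , x′∈R , y′≢y ∘ sym , xy , x′y′)
  ... | no noNegative = y₀ , y₀∈D , λ x′ y′ x′∈R y′∈D _ x′y′ →
    noNegative (y′ , y′∈D , x′ , x′∈R , x′y′)

  eliminate-row : ∀ {R x} → x ∉ R → ¬ TwoNegativeColumns R → Chordal (rows R) →
    ∀ D → Acc _⊂_ D → Chordal (rowStage R x D)
  eliminate-row {R} {x} x∉R oneColumn rowsR D (acc smaller) with nonempty? D
  ... | no empty =
    chordal-resp (λ x′ y′ → spanning-cong (rows? R) (rowStage? R x D) (rowStage-done empty x′ y′)) rowsR
  ... | yes nonempty with next-column oneColumn nonempty
  ...   | y , y∈D , clear =
    step x y (S x y , spanning-present (rowStage? R x D) (inj₂ (refl , y∈D))) (rowStage-simplicial x∉R clear)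
      (chordal-resp (λ x′ y′ → sym (delete-spanning (rowStage? R x D) (rowStage? R x (D - y)) x y
                                                    (rowStage-delete x∉R y) x′ y′))
        (eliminate-row x∉R oneColumn rowsR (D - y) (smaller (x∈p⇒p-x⊂p y∈D))))

  eliminate-rows : (∀ R → Nonempty R → ∃ (Pivot R)) → ∀ R → Acc _⊂_ R → Chordal (rows R)
  eliminate-rows pivot R (acc smaller) with nonempty? R
  ... | no empty = done λ x y → spanning-absent (rows? R) λ x∈R → empty (x , x∈R)
  ... | yes nonempty with pivot R nonempty
  ...   | x , x∈R , oneColumn =
    chordal-resp (λ x′ y′ → spanning-cong (rowStage? (R - x) x ⊤) (rows? R) (rowStage-full x∈R x′ y′))
      (eliminate-row (x∉p-x R x) oneColumn (eliminate-rows pivot (R - x) (smaller (x∈p⇒p-x⊂p x∈R)))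
                     ⊤ (⊂-wellFounded ⊤))

  chordal-if-pivots : (∀ R → Nonempty R → ∃ (Pivot R)) → Chordal (complete S)
  chordal-if-pivots pivot =
    chordal-resp (λ x y → spanning-present (rows? ⊤) ∈⊤) (eliminate-rows pivot ⊤ (⊂-wellFounded ⊤))

-- Locating the obstructions

DistinctRows : (Fin a → Fin b → Sign) → Set
DistinctRows T = ∀ i i′ → i ≢ i′ → ∃ λ j → T i j ≢ T i′ j

distinctRows? : (T : Fin a → Fin b → Sign) → Dec (DistinctRows T)
distinctRows? T = all? λ i → all? λ i′ → ¬? (i ≟ i′) →-dec any? λ j → ¬? (T i j ≟ˢ T i′ j)

placement : {S : Fin m → Fin k → Sign} {T : Fin a → Fin b → Sign} (xs : Fin a → Fin m) (ys : Fin b → Fin k) →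
  Injective _≡_ _≡_ xs → Injective _≡_ _≡_ ys → (∀ i j → S (xs i) (ys j) ≡ T i j) → T ≼ complete S
placement xs ys xs-injective ys-injective signs =
  occurrence xs ys xs-injective ys-injective (λ i j → cong just (signs i j))

rows-separated : (S : Fin m → Fin k → Sign) {T : Fin a → Fin b → Sign} → DistinctRows T →
  (xs : Fin a → Fin m) (ys : Fin b → Fin k) → (∀ i j → S (xs i) (ys j) ≡ T i j) → Injective _≡_ _≡_ xs
rows-separated S distinct xs ys signs {i} {i′} xsi≡xsi′ with i ≟ i′
... | yes i≡i′ = i≡i′
... | no i≢i′ =
  let j , differ = distinct i i′ i≢i′
  in ⊥-elim (differ (trans (sym (signs i j)) (trans (cong (λ x → S x (ys j)) xsi≡xsi′) (signs i′ j))))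

placement-distinct : (S : Fin m → Fin k → Sign) {T : Fin a → Fin b → Sign} →
  DistinctRows T → DistinctRows (flip T) → (xs : Fin a → Fin m) (ys : Fin b → Fin k) →
  (∀ i j → S (xs i) (ys j) ≡ T i j) → T ≼ complete S
placement-distinct S distinctRows distinctColumns xs ys signs =
  placement xs ys (rows-separated S distinctRows xs ys signs)
    (rows-separated (flip S) distinctColumns ys xs (flip signs)) signs

module Patterns (S : Fin m → Fin k → Sign) where

  columns-differ : ∀ {x y y′} → S x y ≡ neg → S x y′ ≡ pos → y ≢ y′
  columns-differ xy xy′ refl with trans (sym xy) xy′
  ... | ()

  M1≼ : ∀ {a b p q} → a ≢ b → p ≢ q →
    S a p ≡ neg → S a q ≡ neg →
    S b p ≡ neg → S b q ≡ neg → M1-signs ≼ complete S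
  M1≼ {a} {b} {p} {q} a≢b p≢q ap aq bp bq =
    placement (lookup (a ∷ b ∷ [])) (lookup (p ∷ q ∷ []))
      (lookup-injective ((a≢b ∷ []) ∷ [] ∷ []) _ _)
      (lookup-injective ((p≢q ∷ []) ∷ [] ∷ []) _ _) λ where
        zero zero → ap ; zero (suc zero) → aq
        (suc zero) zero → bp ; (suc zero) (suc zero) → bq

  M2≼ : ∀ {a b p q r} →
    S a p ≡ neg → S a q ≡ neg → S a r ≡ pos →
    S b p ≡ pos → S b q ≡ neg → S b r ≡ neg → M2-signs ≼ complete S
  M2≼ {a} {b} {p} {q} {r} ap aq ar bp bq br =
    placement-distinct S (from-yes (distinctRows? M2-signs)) (from-yes (distinctRows? (flip M2-signs)))
      (lookup (a ∷ b ∷ [])) (lookup (p ∷ q ∷ r ∷ [])) λ where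
        zero zero → ap ; zero (suc zero) → aq ; zero (suc (suc zero)) → ar
        (suc zero) zero → bp ; (suc zero) (suc zero) → bq ; (suc zero) (suc (suc zero)) → br

  M3≼ : ∀ {a b p q r s} → p ≢ q → r ≢ s →
    S a p ≡ neg → S a q ≡ neg → S a r ≡ pos → S a s ≡ pos →
    S b p ≡ pos → S b q ≡ pos → S b r ≡ neg → S b s ≡ neg → M3-signs ≼ complete S
  M3≼ {a} {b} {p} {q} {r} {s} p≢q r≢s ap aq ar as bp bq br bs =
    placement (lookup (a ∷ b ∷ [])) (lookup (p ∷ q ∷ r ∷ s ∷ []))
      (rows-separated S (from-yes (distinctRows? M3-signs)) _ _ signs)
      (lookup-injective columns-unique _ _) signs
    where
    columns-unique : Unique (p ∷ q ∷ r ∷ s ∷ [])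
    columns-unique = (p≢q ∷ columns-differ ap ar ∷ columns-differ ap as ∷ [])
                   ∷ (columns-differ aq ar ∷ columns-differ aq as ∷ [])
                   ∷ (r≢s ∷ [])
                   ∷ []
                   ∷ []
    signs : ∀ i j → S (lookup (a ∷ b ∷ []) i) (lookup (p ∷ q ∷ r ∷ s ∷ []) j) ≡ M3-signs i j
    signs zero zero = ap
    signs zero (suc zero) = aq
    signs zero (suc (suc zero)) = ar
    signs zero (suc (suc (suc zero))) = as
    signs (suc zero) zero = bp
    signs (suc zero) (suc zero) = bq
    signs (suc zero) (suc (suc zero)) = br
    signs (suc zero) (suc (suc (suc zero))) = bs

  M4≼ : ∀ {a b c p q r} →
    S a p ≡ neg → S a q ≡ pos → S a r ≡ pos →
    S b p ≡ pos → S b q ≡ neg → S b r ≡ pos →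
    S c p ≡ pos → S c q ≡ pos → S c r ≡ neg → M4-signs ≼ complete S
  M4≼ {a} {b} {c} {p} {q} {r} ap aq ar bp bq br cp cq cr =
    placement-distinct S (from-yes (distinctRows? M4-signs)) (from-yes (distinctRows? (flip M4-signs)))
      (lookup (a ∷ b ∷ c ∷ [])) (lookup (p ∷ q ∷ r ∷ [])) λ where
        zero zero → ap ; zero (suc zero) → aq ; zero (suc (suc zero)) → ar
        (suc zero) zero → bp ; (suc zero) (suc zero) → bq ; (suc zero) (suc (suc zero)) → br
        (suc (suc zero)) zero → cp ; (suc (suc zero)) (suc zero) → cq ; (suc (suc zero)) (suc (suc zero)) → cr

  M5≼ : ∀ {a b c p q r} →
    S a p ≡ neg → S a q ≡ neg → S a r ≡ pos →
    S b p ≡ pos → S b q ≡ neg → S b r ≡ pos →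
    S c p ≡ pos → S c q ≡ pos → S c r ≡ neg → M5-signs ≼ complete S
  M5≼ {a} {b} {c} {p} {q} {r} ap aq ar bp bq br cp cq cr =
    placement-distinct S (from-yes (distinctRows? M5-signs)) (from-yes (distinctRows? (flip M5-signs)))
      (lookup (a ∷ b ∷ c ∷ [])) (lookup (p ∷ q ∷ r ∷ [])) λ where
        zero zero → ap ; zero (suc zero) → aq ; zero (suc (suc zero)) → ar
        (suc zero) zero → bp ; (suc zero) (suc zero) → bq ; (suc zero) (suc (suc zero)) → br
        (suc (suc zero)) zero → cp ; (suc (suc zero)) (suc zero) → cq ; (suc (suc zero)) (suc (suc zero)) → cr

-- Pivots of M-free signed complete bigraphs

module M-free {S : Fin m → Fin k → Sign}
  (¬M1 : ¬ M1-signs ≼ complete S)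
  (¬M2 : ¬ M2-signs ≼ complete S) (¬M2ᵀ : ¬ flip M2-signs ≼ complete S)
  (¬M3 : ¬ M3-signs ≼ complete S) (¬M3ᵀ : ¬ flip M3-signs ≼ complete S)
  (¬M4 : ¬ M4-signs ≼ complete S) (¬M5 : ¬ M5-signs ≼ complete S) where

  open Patterns S

  DoublyNegative : Fin m → Set
  DoublyNegative x = ∃₂ λ y y′ → y ≢ y′ × S x y ≡ neg × S x y′ ≡ neg

  doublyNegative? : ∀ x → Dec (DoublyNegative x)
  doublyNegative? x = any? λ y → any? λ y′ → ¬? (y ≟ y′) ×-dec S x y ≟ˢ neg ×-dec S x y′ ≟ˢ neg

  negative-avoiding : ∀ {x} → DoublyNegative x → ∀ y₀ → ∃ λ y → y ≢ y₀ × S x y ≡ neg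
  negative-avoiding (y , y′ , y≢y′ , xy , xy′) y₀ with y ≟ y₀
  ... | yes refl = y′ , y≢y′ ∘ sym , xy′
  ... | no y≢y₀  = y , y≢y₀ , xy

  mixed-rows : ∀ {a b p q} → a ≢ b →
    S a p ≡ neg → S a q ≡ neg → S b p ≡ neg → S b q ≡ pos → ¬ DoublyNegative b
  mixed-rows {a} {b} {p} a≢b ap aq bp bq doubly with negative-avoiding doubly p
  ... | d , d≢p , bd with S a d in ad
  ...   | neg = ¬M1 (M1≼ a≢b (d≢p ∘ sym) ap ad bp bd)
  ...   | pos = ¬M2 (M2≼ aq ap ad bq bp bd)

  doublyNegative-unique : ∀ {a b} → a ≢ b → DoublyNegative a → ¬ DoublyNegative b
  doublyNegative-unique {a} {b} a≢b doublyA@(p , q , p≢q , ap , aq) doublyB@(r , s , r≢s , br , bs)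
    with S b p in bp | S b q in bq
  ... | neg | neg = ¬M1 (M1≼ a≢b p≢q ap aq bp bq)
  ... | neg | pos = mixed-rows a≢b ap aq bp bq doublyB
  ... | pos | neg = mixed-rows a≢b aq ap bq bp doublyB
  ... | pos | pos with S a r in ar | S a s in as
  ...   | neg | neg = ¬M1 (M1≼ a≢b r≢s ar as br bs)
  ...   | neg | pos = mixed-rows (a≢b ∘ sym) br bs ar as doublyA
  ...   | pos | neg = mixed-rows (a≢b ∘ sym) bs br as ar doublyA
  ...   | pos | pos = ¬M3 (M3≼ p≢q r≢s ap aq ar as bp bq br bs)

  doublyNegative-corner : ∀ {a b c p q} → a ≢ b → a ≢ c →
    S a p ≡ neg → S a q ≡ pos →
    S b p ≡ neg → S b q ≡ pos →
    S c p ≡ pos → S c q ≡ neg → ¬ DoublyNegative a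
  doublyNegative-corner {a} {b} {c} {p} {q} a≢b a≢c ap aq bp bq cp cq doubly with negative-avoiding doubly p
  ... | r , r≢p , ar with S b r in br | S c r in cr
  ...   | neg | _   = doublyNegative-unique a≢b doubly (p , r , r≢p ∘ sym , bp , br)
  ...   | pos | neg = doublyNegative-unique a≢c doubly (q , r , (columns-differ ar aq ∘ sym) , cq , cr)
  ...   | pos | pos = ¬M5 (M5≼ ar ap aq br bp bq cr cp cq)

  doublyNegative-isolates : ∀ {a b c p q} → DoublyNegative a → b ≢ a → c ≢ a → p ≢ q →
    S b p ≡ neg → S c q ≡ neg → ⊥
  doublyNegative-isolates {a} {b} {c} {p} {q} doubly@(y , _ , _ , ay , _) b≢a c≢a p≢q bp cq
    with S b q in bq | S c p in cp
  ... | neg | _   = doublyNegative-unique (b≢a ∘ sym) doubly (p , q , p≢q , bp , bq)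
  ... | pos | neg = doublyNegative-unique (c≢a ∘ sym) doubly (q , p , p≢q ∘ sym , cq , cp)
  ... | pos | pos with S a p in ap | S a q in aq
  ...   | neg | neg = ¬M2ᵀ (≼-flip (Patterns.M2≼ (flip S) bp ap cp bq aq cq))
  ...   | neg | pos = doublyNegative-corner (b≢a ∘ sym) (c≢a ∘ sym) ap aq bp bq cp cq doubly
  ...   | pos | neg = doublyNegative-corner (c≢a ∘ sym) (b≢a ∘ sym) aq ap cq cp bq bp doubly
  ...   | pos | pos with S b y in by | S c y in cy
  ...     | neg | _   = doublyNegative-unique (b≢a ∘ sym) doubly (p , y , columns-differ ay ap ∘ sym , bp , by)
  ...     | pos | neg = doublyNegative-unique (c≢a ∘ sym) doubly (q , y , columns-differ ay aq ∘ sym , cq , cy)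
  ...     | pos | pos = ¬M4 (M4≼ ay ap aq by bp bq cy cp cq)

  module _ {R : Subset m} (noneDoubly : ∀ x → x ∈ R → ¬ DoublyNegative x) where

    positive-elsewhere : ∀ {x y y′} → x ∈ R → S x y ≡ neg → y′ ≢ y → S x y′ ≡ pos
    positive-elsewhere {x} {y} {y′} x∈R xy y′≢y with S x y′ in xy′
    ... | pos = refl
    ... | neg = ⊥-elim (noneDoubly x x∈R (y′ , y , y′≢y , xy′ , xy))

    three-negative-columns : ∀ {a b c p q r} → a ∈ R → b ∈ R → c ∈ R → p ≢ q → p ≢ r → q ≢ r →
      S a p ≡ neg → S b q ≡ neg → S c r ≡ neg → ⊥
    three-negative-columns a∈R b∈R c∈R p≢q p≢r q≢r ap bq cr = ¬M4 (M4≼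
      ap (positive-elsewhere a∈R ap (p≢q ∘ sym)) (positive-elsewhere a∈R ap (p≢r ∘ sym))
      (positive-elsewhere b∈R bq p≢q) bq (positive-elsewhere b∈R bq (q≢r ∘ sym))
      (positive-elsewhere c∈R cr p≢r) (positive-elsewhere c∈R cr q≢r) cr)

    negative-partner : ∀ {a b p q} → a ∈ R → b ∈ R → p ≢ q → S a p ≡ neg → S b q ≡ neg →
      TwoNegativeColumns S (R - a) → ∃ λ c → c ≢ a × c ∈ R × S c p ≡ neg
    negative-partner {a} {b} {p} {q} a∈R b∈R p≢q ap bq (c , c′ , r , r′ , c∈R-a , c′∈R-a , r≢r′ , cr , c′r′)
      with r ≟ p | r′ ≟ p
    ... | yes refl | _        = c , x∈p-y⇒x≢y c∈R-a , p─q⊆p R _ c∈R-a , cr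
    ... | no _     | yes refl = c′ , x∈p-y⇒x≢y c′∈R-a , p─q⊆p R _ c′∈R-a , c′r′
    ... | no r≢p   | no r′≢p with r ≟ q
    ...   | no r≢q   =
      ⊥-elim (three-negative-columns a∈R b∈R (p─q⊆p R _ c∈R-a) p≢q (r≢p ∘ sym) (r≢q ∘ sym) ap bq cr)
    ...   | yes refl =
      ⊥-elim (three-negative-columns a∈R b∈R (p─q⊆p R _ c′∈R-a) p≢q (r′≢p ∘ sym) r≢r′ ap bq c′r′)

    some-row-pivots : ∀ {x₀} → x₀ ∈ R → ¬ (∀ x → x ∈ R → TwoNegativeColumns S (R - x))
    some-row-pivots x₀∈R split with split _ x₀∈R
    ... | a , b , p , q , a∈R-x₀ , b∈R-x₀ , p≢q , ap , bq
      with p─q⊆p R _ a∈R-x₀ | p─q⊆p R _ b∈R-x₀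
    ... | a∈R | b∈R
      with negative-partner a∈R b∈R p≢q ap bq (split a a∈R)
         | negative-partner b∈R a∈R (p≢q ∘ sym) bq ap (split b b∈R)
    ... | c , c≢a , c∈R , cp | d , d≢b , d∈R , dq =
      ¬M3ᵀ (≼-flip (Patterns.M3≼ (flip S) (c≢a ∘ sym) (d≢b ∘ sym)
        ap cp (positive-elsewhere b∈R bq p≢q) (positive-elsewhere d∈R dq p≢q)
        (positive-elsewhere a∈R ap (p≢q ∘ sym)) (positive-elsewhere c∈R cp (p≢q ∘ sym)) bq dq))

  doublyNegative-pivot : ∀ {R x} → x ∈ R → DoublyNegative x → Pivot S R x
  doublyNegative-pivot x∈R doubly = x∈R , λ (b , c , p , q , b∈R-x , c∈R-x , p≢q , bp , cq) →
    doublyNegative-isolates doubly (x∈p-y⇒x≢y b∈R-x) (x∈p-y⇒x≢y c∈R-x) p≢q bp cq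

  pivot : ∀ R → Nonempty R → ∃ (Pivot S R)
  pivot R (x₀ , x₀∈R) with any? (λ x → x ∈? R ×-dec doublyNegative? x)
  ... | yes (x , x∈R , doubly) = x , doublyNegative-pivot x∈R doubly
  ... | no noneDoubly with any? (λ x → x ∈? R ×-dec ¬? (twoNegativeColumns? S (R - x)))
  ...   | yes found  = found
  ...   | no noPivot = ⊥-elim (some-row-pivots (λ x x∈R doubly → noneDoubly (x , x∈R , doubly)) x₀∈R
    λ x x∈R → decidable-stable (twoNegativeColumns? S (R - x)) λ oneColumn → noPivot (x , x∈R , oneColumn))

theorem2p3 : (m k : ℕ) (S : Fin m → Fin k → Sign) →
    Chordal (complete S) ⇔
      ((¬ (M1 ⊑ K m k S)) × (¬ (M2 ⊑ K m k S)) × (¬ (M3 ⊑ K m k S)) ×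
       (¬ (M4 ⊑ K m k S)) × (¬ (M5 ⊑ K m k S)))
theorem2p3 m k S = mk⇔
  (λ chordal → excluded M1-signs chordal , excluded M2-signs chordal , excluded M3-signs chordal ,
               excluded M4-signs chordal , excluded M5-signs chordal)
  (λ (¬M1 , ¬M2 , ¬M3 , ¬M4 , ¬M5) → chordal-if-pivots S (M-free.pivot
     (¬≼ ¬M1) (¬≼ ¬M2) (¬flip≼ ¬M2) (¬≼ ¬M3) (¬flip≼ ¬M3) (¬≼ ¬M4) (¬≼ ¬M5)))
  where
  excluded : (T : Fin (suc a) → Fin (suc b) → Sign) → {True (noSimplicialEdge? T)} →
    Chordal (complete S) → ¬ (K (suc a) (suc b) T ⊑ K m k S)
  excluded T {noSimplicial} chordal sub = ⊑⇒¬Chordal (toWitness noSimplicial) sub chordal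

  ¬≼ : {T : Fin a → Fin b → Sign} → ¬ (K a b T ⊑ K m k S) → ¬ T ≼ complete S
  ¬≼ ¬sub = ¬sub ∘ toGraph-⊑⁺ ∘ ≼⇒↪

  ¬flip≼ : {T : Fin a → Fin b → Sign} → ¬ (K a b T ⊑ K m k S) → ¬ flip T ≼ complete S
  ¬flip≼ ¬sub = ¬sub ∘ toGraph-⊑⁺ ∘ flip≼⇒↪
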